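{- Let $D\ge2$ be squarefree, $K=\mathbb{Q}(\sqrt D)$, and let $\alpha\in\mathcal{O}_K^+$, $j\in\mathbb{Z}$, $e\in\mathbb{Z}_{\ge1}$, $f\in\mathbb{Z}_{\ge0}$ with $\alpha=e\beta_j+f\beta_{j+1}$. If $p_K(\alpha)\le6$, then $(e,f)\in\{(1,0),(2,0),(3,0),(4,0),(1,1),(2,1),(1,2)\}$.
   Context: $\mathcal{O}_K^+$: totally positive integers of $K$. $p_K(\alpha)$ is the number of unordered representations $\alpha=\lambda_1+\dots+\lambda_\ell$ ($\ell\ge1$, $\lambda_i\in\mathcal{O}_K^+$). The indecomposable elements of $\mathcal{O}_K^+$ (those not a sum of two elements of $\mathcal{O}_K^+$) form a two-sided sequence $\dots<\beta_{ -1}<\beta_0=1<\beta_1<\dots$ ordered by size, with $\beta_{ -j}=\beta_j'$ (Galois conjugate). Every $\alpha\in\mathcal{O}_K^+$ can be written uniquely as $e\beta_j+f\beta_{j+1}$ with $j\in\mathbb{Z}$, $e\ge1$, $f\ge0$. -}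

module Defs where

open import Data.Nat as ℕ using (ℕ; _%_)
open import Data.Integer as ℤ using (ℤ; +_; _+_; _*_; -_; _-_; _<_; _≤_; 0ℤ)
open import Data.Integer.Divisibility using (_∣_)
open import Data.Nat.Divisibility as ℕD using ()
open import Data.Product using (_×_; _,_; ∃; ∃-syntax; proj₁; proj₂)
open import Data.Sum using (_⊎_)
open import Data.List using (List; []; _∷_; foldr; length)
open import Data.List.Relation.Unary.All using (All)
open import Data.List.Relation.Unary.AllPairs using (AllPairs)
open import Data.List.Relation.Binary.Permutation.Propositional using (_↭_)
open import Relation.Binary.PropositionalEquality using (_≡_; _≢_)
open import Relation.Nullary using (¬_)

SquareFree : ℕ → Set
SquareFree D = ∀ (n : ℕ) → (n ℕ.* n) ℕD.∣ D → n ≡ 1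

-- An element of K = ℚ(√D) of the form (x + y√D)/2 is encoded as the pair (x , y).
Elt : Set
Elt = ℤ × ℤ

_⊕_ : Elt → Elt → Elt
(a , b) ⊕ (c , d) = (a + c , b + d)

_⊖_ : Elt → Elt → Elt
(a , b) ⊖ (c , d) = (a - c , b - d)

_•_ : ℕ → Elt → Elt
e • (a , b) = ((+ e) * a , (+ e) * b)

conj : Elt → Elt
conj (a , b) = (a , - b)

zeroE : Elt
zeroE = (0ℤ , 0ℤ)

sumE : List Elt → Elt
sumE = foldr _⊕_ zeroE

-- membership in the ring of integers O_K (standard integral basis):
-- D ≡ 1 (mod 4): O_K = ℤ[(1+√D)/2], i.e. x ≡ y (mod 2);
-- otherwise:     O_K = ℤ[√D],       i.e. x, y both even.
InOK : ℕ → Elt → Set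
InOK D (x , y) =
  (D % 4 ≡ 1 × (+ 2) ∣ (x - y)) ⊎ (D % 4 ≢ 1 × (+ 2) ∣ x × (+ 2) ∣ y)

-- (x + y√D)/2 > 0 as a real number (D a positive non-square).
Pos : ℕ → Elt → Set
Pos D (x , y) =
  (0ℤ < x × 0ℤ ≤ y)
  ⊎ (0ℤ ≤ x × 0ℤ < y)
  ⊎ (0ℤ < x × y < 0ℤ × (y * y) * (+ D) < x * x)
  ⊎ (x < 0ℤ × 0ℤ < y × x * x < (y * y) * (+ D))

Lt : ℕ → Elt → Elt → Set
Lt D α β = Pos D (β ⊖ α)

TotPos : ℕ → Elt → Set
TotPos D α = InOK D α × Pos D α × Pos D (conj α)

Indecomposable : ℕ → Elt → Set
Indecomposable D α =
  TotPos D α × ¬ (∃[ β ] ∃[ γ ] (TotPos D β × TotPos D γ × α ≡ β ⊕ γ))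

-- β and γ are consecutive indecomposables (β = β_j, γ = β_{j+1} for some j ∈ ℤ)
Consecutive : ℕ → Elt → Elt → Set
Consecutive D β γ =
  Indecomposable D β × Indecomposable D γ × Lt D β γ
  × (∀ δ → Indecomposable D δ → ¬ (Lt D β δ × Lt D δ γ))

-- a representation α = λ₁ + … + λ_ℓ, ℓ ≥ 1, λᵢ ∈ O_K^+, as a list
-- (unordered: lists are compared up to permutation below)
IsPartition : ℕ → Elt → List Elt → Set
IsPartition D α ps = (1 ℕ.≤ length ps) × All (TotPos D) ps × sumE ps ≡ α

-- p_K(α) ≤ m : any family of pairwise distinct (as multisets) partitions has ≤ m members
pK≤ : ℕ → Elt → ℕ → Set
pK≤ D α m = ∀ (pss : List (List Elt))
  → All (IsPartition D α) pss
  → AllPairs (λ p q → ¬ (p ↭ q)) pss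
  → length pss ℕ.≤ m

allowedEF : List (ℕ × ℕ)
allowedEF = (1 , 0) ∷ (2 , 0) ∷ (3 , 0) ∷ (4 , 0) ∷ (1 , 1) ∷ (2 , 1) ∷ (1 , 2) ∷ []

{-# OPTIONS --safe #-}
module Submission where

-- Let α = eβ + fγ. Every pair (n , m) ≠ (0 , 0) gives a totally positive part nβ + mγ, so a
-- partition of (e , f) in ℕ² into non-zero pairs gives a partition of α. Two partitions obtained
-- this way are not permutations of each other as soon as they differ in the number of parts or in
-- how many parts equal β, or γ: as β and γ are distinct and indecomposable, nβ + mγ = β only for
-- (n , m) = (1 , 0), and likewise for γ. Each of (5 , 0), (3 , 1), (2 , 2), (1 , 3) has seven
-- partitions told apart in this way, and adding a part β (or γ) to each of seven partitions of α
-- gives seven partitions of α + β (or α + γ). Every (e , f) with e ≥ 1 outside the allowed list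
-- lies above one of these four pairs, hence p_K(α) ≥ 7. Nothing about β and γ beyond their being
-- distinct and indecomposable is used. That totally positive elements are closed under addition is
-- proved by cases on signs, comparing x with y√D through squares.

open import Data.Empty using (⊥; ⊥-elim)
open import Data.Integer as ℤ using (ℤ; +_; -[1+_]; ∣_∣; +<+; +≤+; -<+)
open import Data.Integer.Divisibility using (_∣_)
import Data.Integer.Divisibility.Signed as Signed
import Data.Integer.Properties as ℤ
import Data.Integer.Tactic.RingSolver as ℤ-Solver
open import Data.List using (List; []; _∷_; length; map; filter; foldr)
open import Data.List.Membership.Propositional using (_∈_)
open import Data.List.Properties using (length-map)
open import Data.List.Relation.Binary.Permutation.Propositional using (_↭_)
open import Data.List.Relation.Binary.Permutation.Propositional.Properties using (↭-length; filter-↭; drop-∷)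
open import Data.List.Relation.Unary.All as All using (All; []; _∷_; all?)
import Data.List.Relation.Unary.All.Properties as All
open import Data.List.Relation.Unary.AllPairs as AllPairs using (AllPairs; allPairs?)
import Data.List.Relation.Unary.AllPairs.Properties as AllPairs
open import Data.List.Relation.Unary.Any using (Any; here; there)
open import Data.Nat as ℕ using (ℕ; zero; suc; _+_; _*_; _≤_; _<_; _≤′_; ≤′-refl; ≤′-step; z≤n; s≤s)
open import Data.Nat.Properties as ℕ
  using ( ≤-trans; <⇒≤; m≤m+n; m≤n+m; ≰⇒>; <-asym; +-mono-<-≤; *-mono-≤; *-monoʳ-≤; *-monoˡ-≤; *-mono-<
        ; +-suc; m≤′m+n; n≮n; module ≤-Reasoning)
import Data.Nat.Tactic.RingSolver as ℕ-Solver
open import Data.Product using (_×_; _,_; ∃-syntax; proj₁; proj₂)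
open import Data.Product.Properties using (≡-dec)
open import Data.Product.Relation.Binary.Pointwise.NonDependent using (Pointwise)
open import Data.Sum using (_⊎_; inj₁; inj₂)
open import Function using (_∘_; _⇔_; mk⇔; Equivalence)
open import Level using (Level)
open import Relation.Binary using (DecidableEquality)
open import Relation.Binary.PropositionalEquality
  using (_≡_; _≢_; refl; sym; trans; cong; cong₂; subst; subst₂; module ≡-Reasoning)
open import Relation.Nullary using (¬_; Dec; yes; no; ¬?; contradiction)
open import Relation.Nullary.Decidable using (True; toWitness; from-yes; _×-dec_)
open import Relation.Unary using (Pred; Decidable)
open import Defs

open import Algebra.Properties.AbelianGroup ℤ.+-0-abelianGroup using (identityʳ-unique)
open import Data.List.Membership.DecPropositional (≡-dec ℕ._≟_ ℕ._≟_) using (_∈?_)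

private variable
  ℓ ℓ' : Level
  A B : Set
  a a' b b' c d D e f k m : ℕ
  α ν : Elt
  ps : List Elt

-- `a √ c < b √ d` stands for a√c < b√d, compared through squares.
infix 4 _√_<_√_ _√_≤_√_
_√_<_√_ _√_≤_√_ : ℕ → ℕ → ℕ → ℕ → Set
a √ c < b √ d = a * a * c < b * b * d
a √ c ≤ b √ d = a * a * c ≤ b * b * d

square-cancel-≤ : a * a ≤ b * b → a ≤ b
square-cancel-≤ {a} {b} a²≤b² with a ℕ.≤? b
... | yes a≤b = a≤b
... | no a≰b  = contradiction a²≤b² (ℕ.<⇒≱ (*-mono-< (≰⇒> a≰b) (≰⇒> a≰b)))

√≤-cross : a √ c ≤ b √ d → a' √ c ≤ b' √ d → a * a' * c ≤ b * b' * d
√≤-cross {a} {c} {b} {d} {a'} {b'} h h' = square-cancel-≤ (begin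
  (a * a' * c) * (a * a' * c)     ≡⟨ regroup a a' c ⟩
  (a * a * c) * (a' * a' * c)     ≤⟨ *-mono-≤ h h' ⟩
  (b * b * d) * (b' * b' * d)     ≡⟨ regroup b b' d ⟨
  (b * b' * d) * (b * b' * d)     ∎)
  where
  open ≤-Reasoning
  regroup : ∀ x y z → (x * y * z) * (x * y * z) ≡ (x * x * z) * (y * y * z)
  regroup = ℕ-Solver.solve-∀

+-mono-√<-√≤ : a √ c < b √ d → a' √ c ≤ b' √ d → (a + a') √ c < (b + b') √ d
+-mono-√<-√≤ {a} {c} {b} {d} {a'} {b'} h h' = begin-strict
  (a + a') * (a + a') * c                       ≡⟨ expand a a' c ⟩
  a * a * c + 2 * (a * a' * c) + a' * a' * c    <⟨ +-mono-<-≤ (+-mono-<-≤ h (*-monoʳ-≤ 2 cross)) h' ⟩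
  b * b * d + 2 * (b * b' * d) + b' * b' * d    ≡⟨ expand b b' d ⟨
  (b + b') * (b + b') * d                       ∎
  where
  open ≤-Reasoning
  expand : ∀ x y z → (x + y) * (x + y) * z ≡ x * x * z + 2 * (x * y * z) + y * y * z
  expand = ℕ-Solver.solve-∀
  cross = √≤-cross {a} {c} {b} {d} {a'} {b'} (<⇒≤ h) h'

+-mono-√≤-√< : a √ c ≤ b √ d → a' √ c < b' √ d → (a + a') √ c < (b + b') √ d
+-mono-√≤-√< {a} {c} {b} {d} {a'} {b'} h h' =
  subst₂ (λ x y → x √ c < y √ d) (ℕ.+-comm a' a) (ℕ.+-comm b' b) (+-mono-√<-√≤ {a'} {c} {b'} {d} {a} {b} h' h)

√<-weaken : a' ≤ a → b ≤ b' → a √ c < b √ d → a' √ c < b' √ d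
√<-weaken {c = c} {d = d} a'≤a b≤b' h =
  ℕ.≤-<-trans (*-monoˡ-≤ c (*-mono-≤ a'≤a a'≤a)) (ℕ.<-≤-trans h (*-monoˡ-≤ d (*-mono-≤ b≤b' b≤b')))

√<-nonzero : a √ c < b √ d → 1 ≤ b
√<-nonzero {b = zero}  ()
√<-nonzero {b = suc _} _ = s≤s z≤n

data Difference (m n : ℕ) : ℤ → Set where
  nonneg : ∀ k → m ≡ k + n → Difference m n (+ k)
  neg    : ∀ k → n ≡ suc k + m → Difference m n -[1+ k ]

difference : ∀ m n → Difference m n (m ℤ.⊖ n)
difference m       zero    = nonneg m (sym (ℕ.+-identityʳ m))
difference zero    (suc n) = neg n (cong suc (sym (ℕ.+-identityʳ n)))
difference (suc m) (suc n) =
  subst (Difference (suc m) (suc n)) (sym (ℤ.[1+m]⊖[1+n]≡m⊖n m n)) (difference-suc (difference m n))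
  where
  difference-suc : ∀ {i} → Difference m n i → Difference (suc m) (suc n) i
  difference-suc (nonneg k m≡k+n) = nonneg k (trans (cong suc m≡k+n) (sym (+-suc k n)))
  difference-suc (neg k n≡1+k+m)  = neg k (trans (cong suc n≡1+k+m) (cong suc (sym (+-suc k m))))

-- x √c + y √d > 0 (for c, d > 0), by cases on the signs of x and y.
SignedPos : ℕ → ℕ → ℤ → ℤ → Set
SignedPos c d (+ p)    (+ q)    = 1 ≤ p + q
SignedPos c d (+ p)    -[1+ q ] = suc q √ d < p √ c
SignedPos c d -[1+ p ] (+ q)    = suc p √ c < q √ d
SignedPos c d -[1+ _ ] -[1+ _ ] = ⊥

SignedPos-swap : ∀ {c d} x y → SignedPos c d x y → SignedPos d c y x
SignedPos-swap (+ p)    (+ q)    h = subst (1 ≤_) (ℕ.+-comm p q) h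
SignedPos-swap (+ _)    -[1+ _ ] h = h
SignedPos-swap -[1+ _ ] (+ _)    h = h

SignedPos-+-comm : ∀ {c d} x y x' y' → SignedPos c d (x' ℤ.+ x) (y' ℤ.+ y) → SignedPos c d (x ℤ.+ x') (y ℤ.+ y')
SignedPos-+-comm {c} {d} x y x' y' = subst₂ (SignedPos c d) (ℤ.+-comm x' x) (ℤ.+-comm y' y)

SignedPos-⁺⁺+⁺⁻ : ∀ {c d} p q p' q' → 1 ≤ p + q → suc q' √ d < p' √ c
                → SignedPos c d (+ (p + p')) (q ℤ.⊖ suc q')
SignedPos-⁺⁺+⁺⁻ {c} {d} p q p' q' _ h' with q ℤ.⊖ suc q' | difference q (suc q')
... | _ | nonneg k _ =
  ≤-trans (√<-nonzero {a = suc q'} {c = d} h') (≤-trans (m≤n+m p' p) (m≤m+n (p + p') k))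
... | _ | neg k 1+q'≡1+k+q =
  √<-weaken (≤-trans (m≤m+n (suc k) q) (ℕ.≤-reflexive (sym 1+q'≡1+k+q))) (m≤n+m p' p) h'

SignedPos-⁺⁻+⁺⁻ : ∀ {c d} p q p' q' → suc q √ d < p √ c → suc q' √ d < p' √ c
                → SignedPos c d (+ (p + p')) (-[1+ suc (q + q') ])
SignedPos-⁺⁻+⁺⁻ {c} {d} p q p' q' h h' =
  subst (λ n → suc n √ d < (p + p') √ c) (+-suc q q') (+-mono-√<-√≤ {suc q} {d} {p} {c} h (<⇒≤ h'))

-- A wrong sign of the sum would give p√c < (1 + q)√d, against the first hypothesis, or
-- q'√d < (1 + p')√c, against the second.
SignedPos-⁺⁻+⁻⁺ : ∀ {c d} p q p' q' → suc q √ d < p √ c → suc p' √ c < q' √ d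
                → SignedPos c d (p ℤ.⊖ suc p') (q' ℤ.⊖ suc q)
SignedPos-⁺⁻+⁻⁺ {c} {d} p q p' q' h h'
  with p ℤ.⊖ suc p' | difference p (suc p') | q' ℤ.⊖ suc q | difference q' (suc q)
... | _ | nonneg zero    refl | _ | nonneg zero    refl = contradiction h' (<-asym h)
... | _ | nonneg zero    refl | _ | nonneg (suc l) _    = s≤s z≤n
... | _ | nonneg (suc k) _    | _ | nonneg l       _    = s≤s z≤n
... | _ | nonneg k       refl | _ | neg l          refl with k * k * c ℕ.≤? suc l * suc l * d
...   | yes k≤l = contradiction (+-mono-√≤-√< {k} {c} {suc l} {d} k≤l h') (<-asym h)
...   | no  k≰l = ≰⇒> k≰l
SignedPos-⁺⁻+⁻⁺ {c} {d} p q p' q' h h'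
    | _ | neg k refl | _ | nonneg l refl with l * l * d ℕ.≤? suc k * suc k * c
...   | yes l≤k = contradiction (+-mono-√≤-√< {l} {d} {suc k} {c} l≤k h) (<-asym h')
...   | no  l≰k = ≰⇒> l≰k
SignedPos-⁺⁻+⁻⁺ {c} {d} p q p' q' h h'
    | _ | neg k refl | _ | neg l refl =
  contradiction (√<-weaken (m≤n+m p (suc k)) (m≤n+m q' (suc l)) h') (<-asym h)

-- The other sign patterns follow by commuting the summands or by exchanging (x , c) with (y , d).
SignedPos-+ : ∀ {c d} x y x' y' → SignedPos c d x y → SignedPos c d x' y' → SignedPos c d (x ℤ.+ x') (y ℤ.+ y')
SignedPos-+ (+ p) (+ q) (+ p') (+ q') h h' = ≤-trans h (ℕ.+-mono-≤ (m≤m+n p p') (m≤m+n q q'))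
SignedPos-+ (+ p) (+ q) (+ p') -[1+ q' ] h h' = SignedPos-⁺⁺+⁺⁻ p q p' q' h h'
SignedPos-+ (+ p) (+ q) -[1+ p' ] (+ q') h h' =
  SignedPos-swap (+ q ℤ.+ + q') (+ p ℤ.+ -[1+ p' ])
    (SignedPos-⁺⁺+⁺⁻ q p q' p' (subst (1 ≤_) (ℕ.+-comm p q) h) h')
SignedPos-+ (+ p) -[1+ q ] (+ p') (+ q') h h' =
  SignedPos-+-comm (+ p) -[1+ q ] (+ p') (+ q') (SignedPos-⁺⁺+⁺⁻ p' q' p q h' h)
SignedPos-+ (+ p) -[1+ q ] (+ p') -[1+ q' ] h h' = SignedPos-⁺⁻+⁺⁻ p q p' q' h h'
SignedPos-+ (+ p) -[1+ q ] -[1+ p' ] (+ q') h h' = SignedPos-⁺⁻+⁻⁺ p q p' q' h h'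
SignedPos-+ {c} {d} -[1+ p ] (+ q) (+ p') (+ q') h h' =
  SignedPos-+-comm -[1+ p ] (+ q) (+ p') (+ q')
    (SignedPos-swap (+ q' ℤ.+ + q) (+ p' ℤ.+ -[1+ p ])
      (SignedPos-⁺⁺+⁺⁻ {d} {c} q' p' q p (subst (1 ≤_) (ℕ.+-comm p' q') h') h))
SignedPos-+ -[1+ p ] (+ q) (+ p') -[1+ q' ] h h' =
  SignedPos-+-comm -[1+ p ] (+ q) (+ p') -[1+ q' ] (SignedPos-⁺⁻+⁻⁺ p' q' p q h' h)
SignedPos-+ {c} {d} -[1+ p ] (+ q) -[1+ p' ] (+ q') h h' =
  SignedPos-swap {d} {c} (+ q ℤ.+ + q') (-[1+ p ] ℤ.+ -[1+ p' ]) (SignedPos-⁺⁻+⁺⁻ {d} {c} q p q' p' h h')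

square-scaled : ∀ x n → x ℤ.* x ℤ.* + n ≡ + (∣ x ∣ * ∣ x ∣ * n)
square-scaled x n = trans (cong (ℤ._* + n) (square x)) (sym (ℤ.pos-* (∣ x ∣ * ∣ x ∣) n))
  where
  square : ∀ x → x ℤ.* x ≡ + (∣ x ∣ * ∣ x ∣)
  square (+ p)    = sym (ℤ.pos-* p p)
  square -[1+ p ] = refl

square-unscaled : ∀ x → x ℤ.* x ≡ + (∣ x ∣ * ∣ x ∣ * 1)
square-unscaled x = trans (sym (ℤ.*-identityʳ (x ℤ.* x))) (square-scaled x 1)

Pos⇒SignedPos : ∀ {x y} → Pos D (x , y) → SignedPos 1 D x y
Pos⇒SignedPos (inj₁ (+<+ 0<p , +≤+ _))        = ≤-trans 0<p (m≤m+n _ _)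
Pos⇒SignedPos (inj₂ (inj₁ (+≤+ _ , +<+ 0<q))) = ≤-trans 0<q (m≤n+m _ _)
Pos⇒SignedPos {D} {x} {y} (inj₂ (inj₂ (inj₁ (+<+ _ , -<+ , h)))) =
  ℤ.drop‿+<+ (subst₂ ℤ._<_ (square-scaled y D) (square-unscaled x) h)
Pos⇒SignedPos (inj₂ (inj₂ (inj₁ (_ , +<+ () , _))))
Pos⇒SignedPos {D} {x} {y} (inj₂ (inj₂ (inj₂ (-<+ , +<+ _ , h)))) =
  ℤ.drop‿+<+ (subst₂ ℤ._<_ (square-unscaled x) (square-scaled y D) h)
Pos⇒SignedPos (inj₂ (inj₂ (inj₂ (+<+ () , _))))

SignedPos⇒Pos : ∀ x y → SignedPos 1 D x y → Pos D (x , y)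
SignedPos⇒Pos (+ zero)  (+ zero)  ()
SignedPos⇒Pos (+ zero)  (+ suc q) _ = inj₂ (inj₁ (+≤+ z≤n , +<+ (s≤s z≤n)))
SignedPos⇒Pos (+ suc p) (+ q)     _ = inj₁ (+<+ (s≤s z≤n) , +≤+ z≤n)
SignedPos⇒Pos {D} (+ p) -[1+ q ] h =
  inj₂ (inj₂ (inj₁ (+<+ (√<-nonzero {a = suc q} {c = D} h) , -<+ ,
    subst₂ ℤ._<_ (sym (square-scaled -[1+ q ] D)) (sym (square-unscaled (+ p))) (+<+ h))))
SignedPos⇒Pos {D} -[1+ p ] (+ q) h =
  inj₂ (inj₂ (inj₂ (-<+ , +<+ (√<-nonzero {a = suc p} {c = 1} h) ,
    subst₂ ℤ._<_ (sym (square-unscaled -[1+ p ])) (sym (square-scaled (+ q) D)) (+<+ h))))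

¬Pos-zeroE : ¬ Pos D zeroE
¬Pos-zeroE {D} pos with () ← Pos⇒SignedPos {D} pos

Pos-⊕ : ∀ {u v} → Pos D u → Pos D v → Pos D (u ⊕ v)
Pos-⊕ {u = x , y} {x' , y'} pos pos' =
  SignedPos⇒Pos _ _ (SignedPos-+ x y x' y' (Pos⇒SignedPos pos) (Pos⇒SignedPos pos'))

⊕-comm : ∀ u v → u ⊕ v ≡ v ⊕ u
⊕-comm (a , b) (c , d) = cong₂ _,_ (ℤ.+-comm a c) (ℤ.+-comm b d)

⊕-identityʳ-unique : ∀ u v → u ⊕ v ≡ u → v ≡ zeroE
⊕-identityʳ-unique (a , b) (c , d) eq =
  cong₂ _,_ (identityʳ-unique a c (cong proj₁ eq)) (identityʳ-unique b d (cong proj₂ eq))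

u⊖u≡zeroE : ∀ u → u ⊖ u ≡ zeroE
u⊖u≡zeroE (a , b) = cong₂ _,_ (ℤ.+-inverseʳ a) (ℤ.+-inverseʳ b)

conj-distrib-⊕ : ∀ u v → conj (u ⊕ v) ≡ conj u ⊕ conj v
conj-distrib-⊕ (a , b) (c , d) = cong (a ℤ.+ c ,_) (ℤ.neg-distrib-+ b d)

∣m∣n⇒∣m+n : ∀ k i j → k ∣ i → k ∣ j → k ∣ i ℤ.+ j
∣m∣n⇒∣m+n k i j k∣i k∣j =
  Signed.∣⇒∣ᵤ (Signed.∣m∣n⇒∣m+n {k} {i} {j} (Signed.∣ᵤ⇒∣ {k} {i} k∣i) (Signed.∣ᵤ⇒∣ {k} {j} k∣j))

InOK-⊕ : ∀ u v → InOK D u → InOK D v → InOK D (u ⊕ v)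
InOK-⊕ (x , y) (x' , y') (inj₁ (D≡1 , 2∣x-y)) (inj₁ (_ , 2∣x'-y')) =
  inj₁ (D≡1 , subst (+ 2 ∣_) (regroup x y x' y') (∣m∣n⇒∣m+n (+ 2) (x ℤ.- y) (x' ℤ.- y') 2∣x-y 2∣x'-y'))
  where
  regroup : ∀ x y x' y' → (x ℤ.- y) ℤ.+ (x' ℤ.- y') ≡ (x ℤ.+ x') ℤ.- (y ℤ.+ y')
  regroup = ℤ-Solver.solve-∀
InOK-⊕ _ _ (inj₁ (D≡1 , _)) (inj₂ (D≢1 , _)) = contradiction D≡1 D≢1
InOK-⊕ _ _ (inj₂ (D≢1 , _)) (inj₁ (D≡1 , _)) = contradiction D≡1 D≢1
InOK-⊕ (x , y) (x' , y') (inj₂ (D≢1 , 2∣x , 2∣y)) (inj₂ (_ , 2∣x' , 2∣y')) =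
  inj₂ (D≢1 , ∣m∣n⇒∣m+n (+ 2) x x' 2∣x 2∣x' , ∣m∣n⇒∣m+n (+ 2) y y' 2∣y 2∣y')

TotPos-⊕ : ∀ {D u v} → TotPos D u → TotPos D v → TotPos D (u ⊕ v)
TotPos-⊕ {D} {u} {v} (int , pos , pos′) (int' , pos' , pos′') =
  InOK-⊕ {D} u v int int' , Pos-⊕ {D} pos pos' , subst (Pos D) (sym (conj-distrib-⊕ u v)) (Pos-⊕ {D} pos′ pos′')

¬TotPos-zeroE : ¬ TotPos D zeroE
¬TotPos-zeroE {D} (_ , pos , _) = ¬Pos-zeroE {D} pos

Lt⇒≢ : ∀ {u v} → Lt D u v → u ≢ v
Lt⇒≢ {D} {u} u<u refl = ¬Pos-zeroE {D} (subst (Pos D) (u⊖u≡zeroE u) u<u)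

infixl 6 _+²_
_+²_ : ℕ × ℕ → ℕ × ℕ → ℕ × ℕ
(n , m) +² (n' , m') = (n + n' , m + m')

comb : Elt → Elt → ℕ × ℕ → Elt
comb δ ε (n , m) = (n • δ) ⊕ (m • ε)

comb-+ : ∀ δ ε x y → comb δ ε (x +² y) ≡ comb δ ε x ⊕ comb δ ε y
comb-+ (a , b) (c , d) (n , m) (n' , m') = cong₂ _,_ (linear a c) (linear b d)
  where
  interchange : ∀ i i' j j' a c → (i ℤ.+ i') ℤ.* a ℤ.+ (j ℤ.+ j') ℤ.* c
                                ≡ (i ℤ.* a ℤ.+ j ℤ.* c) ℤ.+ (i' ℤ.* a ℤ.+ j' ℤ.* c)
  interchange = ℤ-Solver.solve-∀
  linear : ∀ a c → + (n + n') ℤ.* a ℤ.+ + (m + m') ℤ.* c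
                 ≡ (+ n ℤ.* a ℤ.+ + m ℤ.* c) ℤ.+ (+ n' ℤ.* a ℤ.+ + m' ℤ.* c)
  linear a c rewrite ℤ.pos-+ n n' | ℤ.pos-+ m m' = interchange (+ n) (+ n') (+ m) (+ m') a c

comb-swap : ∀ δ ε n m → comb δ ε (n , m) ≡ comb ε δ (m , n)
comb-swap δ ε n m = ⊕-comm (n • δ) (m • ε)

comb-unit : ∀ δ ε → comb δ ε (1 , 0) ≡ δ
comb-unit (a , b) _ = cong₂ _,_ (unit a) (unit b)
  where
  unit : ∀ i → + 1 ℤ.* i ℤ.+ + 0 ≡ i
  unit i = trans (ℤ.+-identityʳ _) (ℤ.*-identityˡ i)

comb-sucˡ : ∀ δ ε n m → comb δ ε (suc n , m) ≡ δ ⊕ comb δ ε (n , m)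
comb-sucˡ δ ε n m = trans (comb-+ δ ε (1 , 0) (n , m)) (cong (_⊕ comb δ ε (n , m)) (comb-unit δ ε))

comb-sucʳ : ∀ δ ε n m → comb δ ε (n , suc m) ≡ ε ⊕ comb δ ε (n , m)
comb-sucʳ δ ε n m = begin
  comb δ ε (n , suc m)     ≡⟨ comb-swap δ ε n (suc m) ⟩
  comb ε δ (suc m , n)     ≡⟨ comb-sucˡ ε δ m n ⟩
  ε ⊕ comb ε δ (m , n)     ≡⟨ cong (ε ⊕_) (comb-swap ε δ m n) ⟩
  ε ⊕ comb δ ε (n , m)     ∎
  where open ≡-Reasoning

module _ {D : ℕ} {δ ε : Elt} (δ⁺ : TotPos D δ) (ε⁺ : TotPos D ε) where

  comb-TotPos : ∀ n m → 1 ≤ n + m → TotPos D (comb δ ε (n , m))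
  comb-TotPos (suc zero)    zero          _ = subst (TotPos D) (sym (comb-unit δ ε)) δ⁺
  comb-TotPos (suc (suc n)) m             _ =
    subst (TotPos D) (sym (comb-sucˡ δ ε (suc n) m)) (TotPos-⊕ δ⁺ (comb-TotPos (suc n) m (s≤s z≤n)))
  comb-TotPos (suc zero)    (suc m)       _ =
    subst (TotPos D) (sym (comb-sucʳ δ ε 1 m)) (TotPos-⊕ ε⁺ (comb-TotPos 1 m (s≤s z≤n)))
  comb-TotPos zero          (suc zero)    _ =
    subst (TotPos D) (sym (trans (comb-swap δ ε 0 1) (comb-unit ε δ))) ε⁺
  comb-TotPos zero          (suc (suc m)) _ =
    subst (TotPos D) (sym (comb-sucʳ δ ε 0 (suc m))) (TotPos-⊕ ε⁺ (comb-TotPos 0 (suc m) (s≤s z≤n)))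

  comb-≡-zeroE : ∀ n m → comb δ ε (n , m) ≡ zeroE → (n , m) ≡ (0 , 0)
  comb-≡-zeroE zero    zero    _  = refl
  comb-≡-zeroE zero    (suc m) eq =
    ⊥-elim (¬TotPos-zeroE {D} (subst (TotPos D) eq (comb-TotPos 0 (suc m) (s≤s z≤n))))
  comb-≡-zeroE (suc n) m       eq =
    ⊥-elim (¬TotPos-zeroE {D} (subst (TotPos D) eq (comb-TotPos (suc n) m (s≤s z≤n))))

module _ {D : ℕ} {δ ε : Elt} (δ-indec : Indecomposable D δ) (ε⁺ : TotPos D ε) (δ≢ε : δ ≢ ε) where

  private
    δ⁺ = proj₁ δ-indec

  comb-≡-indecomposable : ∀ n m → comb δ ε (n , m) ≡ δ → (n , m) ≡ (1 , 0)
  comb-≡-indecomposable zero zero eq = ⊥-elim (¬TotPos-zeroE {D} (subst (TotPos D) (sym eq) δ⁺))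
  comb-≡-indecomposable zero (suc zero) eq =
    ⊥-elim (δ≢ε (trans (sym eq) (trans (comb-swap δ ε 0 1) (comb-unit ε δ))))
  comb-≡-indecomposable zero (suc (suc m)) eq =
    ⊥-elim (proj₂ δ-indec (ε , comb δ ε (0 , suc m) , ε⁺ , comb-TotPos δ⁺ ε⁺ 0 (suc m) (s≤s z≤n) ,
                           trans (sym eq) (comb-sucʳ δ ε 0 (suc m))))
  comb-≡-indecomposable (suc n) m eq
    with comb-≡-zeroE δ⁺ ε⁺ n m (⊕-identityʳ-unique δ _ (trans (sym (comb-sucˡ δ ε n m)) eq))
  ... | refl = refl

pK≥ : ℕ → Elt → ℕ → Set
pK≥ D α k = ∃[ pss ] length pss ≡ k × All (IsPartition D α) pss × AllPairs (λ p q → ¬ (p ↭ q)) pss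

pK≤-pK≥⇒≤ : pK≤ D α m → pK≥ D α k → k ≤ m
pK≤-pK≥⇒≤ pK≤ (pss , refl , partitions , distinct) = pK≤ pss partitions distinct

IsPartition-∷ : TotPos D ν → IsPartition D α ps → IsPartition D (ν ⊕ α) (ν ∷ ps)
IsPartition-∷ ν⁺ (_ , parts⁺ , refl) = s≤s z≤n , ν⁺ ∷ parts⁺ , refl

pK≥-⊕ : TotPos D ν → pK≥ D α k → pK≥ D (ν ⊕ α) k
pK≥-⊕ {ν = ν} ν⁺ (pss , refl , partitions , distinct) =
  map (ν ∷_) pss , length-map (ν ∷_) pss ,
  All.map⁺ (All.map (IsPartition-∷ ν⁺) partitions) ,
  AllPairs.map⁺ (AllPairs.map (_∘ drop-∷) distinct)

count : {P : Pred A ℓ} → Decidable P → List A → ℕ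
count P? = length ∘ filter P?

count-map : {P : Pred B ℓ} {Q : Pred A ℓ'} (P? : Decidable P) (Q? : Decidable Q) {g : A → B}
          → (∀ x → P (g x) ⇔ Q x) → ∀ xs → count P? (map g xs) ≡ count Q? xs
count-map P? Q? P⇔Q [] = refl
count-map P? Q? {g} P⇔Q (x ∷ xs) with P? (g x) | Q? x
... | yes _   | yes _  = cong suc (count-map P? Q? P⇔Q xs)
... | no _    | no _   = count-map P? Q? P⇔Q xs
... | yes Pgx | no ¬Qx = contradiction (Equivalence.to (P⇔Q x) Pgx) ¬Qx
... | no ¬Pgx | yes Qx = contradiction (Equivalence.from (P⇔Q x) Qx) ¬Pgx

profile : DecidableEquality A → A → A → List A → ℕ × ℕ × ℕ
profile _≟_ a b xs = length xs , count (_≟ a) xs , count (_≟ b) xs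

profile-↭ : (_≟_ : DecidableEquality A) (a b : A) {xs ys : List A}
          → xs ↭ ys → profile _≟_ a b xs ≡ profile _≟_ a b ys
profile-↭ _≟_ a b xs↭ys =
  cong₂ _,_ (↭-length xs↭ys) (cong₂ _,_ (↭-length (filter-↭ (_≟ a) xs↭ys)) (↭-length (filter-↭ (_≟ b) xs↭ys)))

profile-map : (_≟_ : DecidableEquality B) (_≟'_ : DecidableEquality A) {a b : B} {a' b' : A} {g : A → B}
            → (∀ x → g x ≡ a ⇔ x ≡ a') → (∀ x → g x ≡ b ⇔ x ≡ b')
            → ∀ xs → profile _≟_ a b (map g xs) ≡ profile _≟'_ a' b' xs
profile-map _≟_ _≟'_ {a} {b} {a'} {b'} {g} ga⇔ gb⇔ xs =
  cong₂ _,_ (length-map g xs) (cong₂ _,_ (count-map (_≟ a) (_≟' a') ga⇔ xs) (count-map (_≟ b) (_≟' b') gb⇔ xs))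

_≟²_ : DecidableEquality (ℕ × ℕ)
_≟²_ = ≡-dec ℕ._≟_ ℕ._≟_

_≟ᴱ_ : DecidableEquality Elt
_≟ᴱ_ = ≡-dec ℤ._≟_ ℤ._≟_

-- The shape [(n₁ , m₁) , …] stands for the partition of (∑ nᵢ)β + (∑ mᵢ)γ into the parts nᵢβ + mᵢγ.
Shape : Set
Shape = List (ℕ × ℕ)

IsShapeOf : ℕ × ℕ → Shape → Set
IsShapeOf x s = 1 ≤ length s × All (λ (n , m) → 1 ≤ n + m) s × foldr _+²_ (0 , 0) s ≡ x

shapeProfile : Shape → ℕ × ℕ × ℕ
shapeProfile = profile _≟²_ (1 , 0) (0 , 1)

ShapeFamily : ℕ × ℕ → List Shape → Set
ShapeFamily x ss = All (IsShapeOf x) ss × AllPairs (λ s t → shapeProfile s ≢ shapeProfile t) ss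

shapeFamily? : ∀ x ss → Dec (ShapeFamily x ss)
shapeFamily? x ss = all? isShapeOf? ss ×-dec allPairs? (λ s t → ¬? (shapeProfile s ≟³ shapeProfile t)) ss
  where
  isShapeOf? : ∀ s → Dec (IsShapeOf x s)
  isShapeOf? s = 1 ℕ.≤? length s ×-dec all? (λ (n , m) → 1 ℕ.≤? n + m) s ×-dec foldr _+²_ (0 , 0) s ≟² x
  _≟³_ : DecidableEquality (ℕ × ℕ × ℕ)
  _≟³_ = ≡-dec ℕ._≟_ _≟²_

module Realisation {D : ℕ} {β γ : Elt}
  (β-indec : Indecomposable D β) (γ-indec : Indecomposable D γ) (β≢γ : β ≢ γ) where

  private
    β⁺ = proj₁ β-indec
    γ⁺ = proj₁ γ-indec

  piece : ℕ × ℕ → Elt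
  piece = comb β γ

  piece≡β⇔ : ∀ x → piece x ≡ β ⇔ x ≡ (1 , 0)
  piece≡β⇔ (n , m) = mk⇔ (comb-≡-indecomposable β-indec γ⁺ β≢γ n m) λ { refl → comb-unit β γ }

  piece≡γ⇔ : ∀ x → piece x ≡ γ ⇔ x ≡ (0 , 1)
  piece≡γ⇔ (n , m) = mk⇔ piece≡γ⇒ λ { refl → trans (comb-swap β γ 0 1) (comb-unit γ β) }
    where
    piece≡γ⇒ : piece (n , m) ≡ γ → (n , m) ≡ (0 , 1)
    piece≡γ⇒ eq with comb-≡-indecomposable γ-indec β⁺ (β≢γ ∘ sym) m n (trans (sym (comb-swap β γ n m)) eq)
    ... | refl = refl

  sum-pieces : ∀ s → sumE (map piece s) ≡ piece (foldr _+²_ (0 , 0) s)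
  sum-pieces []      = refl
  sum-pieces (x ∷ s) = trans (cong (piece x ⊕_) (sum-pieces s)) (sym (comb-+ β γ x _))

  pieces-partition : ∀ {x s} → IsShapeOf x s → IsPartition D (piece x) (map piece s)
  pieces-partition {s = s} (nonempty , parts , refl) =
    subst (1 ≤_) (sym (length-map piece s)) nonempty ,
    All.map⁺ (All.map (λ {(n , m)} → comb-TotPos β⁺ γ⁺ n m) parts) ,
    sum-pieces s

  pieces-↭ : ∀ {s t} → map piece s ↭ map piece t → shapeProfile s ≡ shapeProfile t
  pieces-↭ {s} {t} s↭t = begin
    shapeProfile s                  ≡⟨ profile-map _≟ᴱ_ _≟²_ piece≡β⇔ piece≡γ⇔ s ⟨
    profile _≟ᴱ_ β γ (map piece s)  ≡⟨ profile-↭ _≟ᴱ_ β γ s↭t ⟩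
    profile _≟ᴱ_ β γ (map piece t)  ≡⟨ profile-map _≟ᴱ_ _≟²_ piece≡β⇔ piece≡γ⇔ t ⟩
    shapeProfile t                  ∎
    where open ≡-Reasoning

  ShapeFamily⇒pK≥ : ∀ {x ss} → length ss ≡ k → ShapeFamily x ss → pK≥ D (piece x) k
  ShapeFamily⇒pK≥ {ss = ss} refl (shapes , distinct) =
    map (map piece) ss , length-map (map piece) ss ,
    All.map⁺ (All.map pieces-partition shapes) ,
    AllPairs.map⁺ (AllPairs.map (_∘ pieces-↭) distinct)

  pK≥-piece-mono : ∀ {e₀ f₀ e f k} → e₀ ≤′ e → f₀ ≤′ f → pK≥ D (piece (e₀ , f₀)) k → pK≥ D (piece (e , f)) k
  pK≥-piece-mono ≤′-refl ≤′-refl many = many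
  pK≥-piece-mono {e₀} {f₀} {suc e} {f} (≤′-step e₀≤e) f₀≤f many =
    subst (λ α → pK≥ D α _) (sym (comb-sucˡ β γ e f)) (pK≥-⊕ β⁺ (pK≥-piece-mono {e₀} {f₀} e₀≤e f₀≤f many))
  pK≥-piece-mono {e₀} {f₀} {e} {suc f} ≤′-refl (≤′-step f₀≤f) many =
    subst (λ α → pK≥ D α _) (sym (comb-sucʳ β γ e f)) (pK≥-⊕ γ⁺ (pK≥-piece-mono {e₀} {f₀} ≤′-refl f₀≤f many))

minimalExceptions : List (ℕ × ℕ)
minimalExceptions = (5 , 0) ∷ (3 , 1) ∷ (2 , 2) ∷ (1 , 3) ∷ []

-- Only ever applied to the entries of minimalExceptions.
sevenShapes : ℕ × ℕ → List Shape
sevenShapes (5 , 0) =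
  ((5 , 0) ∷ []) ∷ ((4 , 0) ∷ (1 , 0) ∷ []) ∷ ((3 , 0) ∷ (2 , 0) ∷ []) ∷ ((3 , 0) ∷ (1 , 0) ∷ (1 , 0) ∷ []) ∷
  ((2 , 0) ∷ (2 , 0) ∷ (1 , 0) ∷ []) ∷ ((2 , 0) ∷ (1 , 0) ∷ (1 , 0) ∷ (1 , 0) ∷ []) ∷
  ((1 , 0) ∷ (1 , 0) ∷ (1 , 0) ∷ (1 , 0) ∷ (1 , 0) ∷ []) ∷ []
sevenShapes (3 , 1) =
  ((3 , 1) ∷ []) ∷ ((3 , 0) ∷ (0 , 1) ∷ []) ∷ ((2 , 1) ∷ (1 , 0) ∷ []) ∷ ((2 , 0) ∷ (1 , 1) ∷ []) ∷
  ((2 , 0) ∷ (1 , 0) ∷ (0 , 1) ∷ []) ∷ ((1 , 1) ∷ (1 , 0) ∷ (1 , 0) ∷ []) ∷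
  ((1 , 0) ∷ (1 , 0) ∷ (1 , 0) ∷ (0 , 1) ∷ []) ∷ []
sevenShapes (2 , 2) =
  ((2 , 2) ∷ []) ∷ ((2 , 1) ∷ (0 , 1) ∷ []) ∷ ((2 , 0) ∷ (0 , 2) ∷ []) ∷ ((2 , 0) ∷ (0 , 1) ∷ (0 , 1) ∷ []) ∷
  ((1 , 2) ∷ (1 , 0) ∷ []) ∷ ((1 , 1) ∷ (1 , 0) ∷ (0 , 1) ∷ []) ∷ ((1 , 0) ∷ (1 , 0) ∷ (0 , 2) ∷ []) ∷ []
sevenShapes (1 , 3) =
  ((1 , 3) ∷ []) ∷ ((1 , 2) ∷ (0 , 1) ∷ []) ∷ ((1 , 1) ∷ (0 , 2) ∷ []) ∷ ((1 , 1) ∷ (0 , 1) ∷ (0 , 1) ∷ []) ∷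
  ((1 , 0) ∷ (0 , 3) ∷ []) ∷ ((1 , 0) ∷ (0 , 2) ∷ (0 , 1) ∷ []) ∷ ((1 , 0) ∷ (0 , 1) ∷ (0 , 1) ∷ (0 , 1) ∷ []) ∷ []
sevenShapes _ = []

sevenShapes-family : All (λ x → length (sevenShapes x) ≡ 7 × ShapeFamily x (sevenShapes x)) minimalExceptions
sevenShapes-family =
  from-yes (all? (λ x → length (sevenShapes x) ℕ.≟ 7 ×-dec shapeFamily? x (sevenShapes x)) minimalExceptions)

AboveMinimalException : ℕ → ℕ → Set
AboveMinimalException e f = Any (λ x → Pointwise _≤′_ _≤′_ x (e , f)) minimalExceptions

aboveMinimalException-pK≥7 : ∀ {D β γ} → Indecomposable D β → Indecomposable D γ → β ≢ γ
                           → AboveMinimalException e f → pK≥ D (comb β γ (e , f)) 7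
aboveMinimalException-pK≥7 β-indec γ-indec β≢γ =
  All.lookupWith (λ (has7 , family) (e₀≤e , f₀≤f) → pK≥-piece-mono e₀≤e f₀≤f (ShapeFamily⇒pK≥ has7 family))
                 sevenShapes-family
  where open Realisation β-indec γ-indec β≢γ

allowed : ∀ {x} {x∈? : True (x ∈? allowedEF)} → x ∈ allowedEF
allowed {x∈? = x∈?} = toWitness x∈?

allowed⊎aboveMinimalException : ∀ e f → 1 ≤ e → (e , f) ∈ allowedEF ⊎ AboveMinimalException e f
allowed⊎aboveMinimalException 1 0 _ = inj₁ allowed
allowed⊎aboveMinimalException 2 0 _ = inj₁ allowed
allowed⊎aboveMinimalException 3 0 _ = inj₁ allowed
allowed⊎aboveMinimalException 4 0 _ = inj₁ allowed
allowed⊎aboveMinimalException (suc (suc (suc (suc (suc e))))) 0 _ = inj₂ (here (m≤′m+n 5 e , ≤′-refl))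
allowed⊎aboveMinimalException 1 1 _ = inj₁ allowed
allowed⊎aboveMinimalException 2 1 _ = inj₁ allowed
allowed⊎aboveMinimalException (suc (suc (suc e))) 1 _ = inj₂ (there (here (m≤′m+n 3 e , ≤′-refl)))
allowed⊎aboveMinimalException 1 2 _ = inj₁ allowed
allowed⊎aboveMinimalException (suc (suc e)) (suc (suc f)) _ =
  inj₂ (there (there (here (m≤′m+n 2 e , m≤′m+n 2 f))))
allowed⊎aboveMinimalException 1 (suc (suc (suc f))) _ =
  inj₂ (there (there (there (here (≤′-refl , m≤′m+n 3 f)))))

lemma7p2 : (D : ℕ) → 2 ≤ D → SquareFree D
    → (α β γ : Elt) (e f : ℕ)
    → TotPos D α → Consecutive D β γ → 1 ≤ e
    → α ≡ (e • β) ⊕ (f • γ)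
    → pK≤ D α 6
    → (e , f) ∈ allowedEF
lemma7p2 D _ _ α β γ e f _ (β-indec , γ-indec , β<γ , _) 1≤e refl pK≤6
  with allowed⊎aboveMinimalException e f 1≤e
... | inj₁ ef-allowed = ef-allowed
... | inj₂ above =
  contradiction (pK≤-pK≥⇒≤ pK≤6 (aboveMinimalException-pK≥7 β-indec γ-indec (Lt⇒≢ β<γ) above)) (n≮n 6)
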